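{- Let $m,n,t$ be positive integers, let $T\subset[m]$ consist of $t$ consecutive integers, and let $\beta\in T$ be chosen uniformly at random. Then for any $i\in[n]$ and any set $S\subset[n]$ of $l$ consecutive integers, \[ \Pr[\beta i \bmod n\in S]\le \lceil im/n\rceil\,(1+\lfloor l/i\rfloor)/t\le \frac1t+\frac{im}{nt}+\frac{lm}{nt}+\frac{l}{it}. \]
   Context: $[n]=\{1,\dots,n\}$; $\beta i \bmod n$ denotes the residue of $\beta i$ modulo $n$, identified with an element of $[n]$. -}

module Defs where

open import Data.Bool using (Bool; _∧_)
open import Data.Nat using (ℕ; zero; suc; _+_; _*_; _∸_; _%_; _≡ᵇ_; _≤ᵇ_; _<ᵇ_; NonZero)
open import Data.Nat.Properties using (m*n≢0)
open import Data.List using (List; length; filterᵇ; map; upTo)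
open import Data.Integer using (+_)
open import Data.Rational using (ℚ; _/_)
open import Data.Bool using (if_then_else_)

-- product of nonzero naturals is nonzero (instance, so that e.g. x / (n * t) typechecks)
instance
  nz* : ∀ {m n} {{_ : NonZero m}} {{_ : NonZero n}} → NonZero (m * n)
  nz* {m} {n} = m*n≢0 m n

-- residue of x modulo n, identified with an element of [n] = {1,…,n}
-- (residue 0 is represented by n)
resid : (n : ℕ) .{{_ : NonZero n}} → ℕ → ℕ
resid n x = if (x % n) ≡ᵇ 0 then n else x % n

block : (a l : ℕ) → List ℕ
block a l = map (λ k → a + k) (upTo l)

inBlock : (a l : ℕ) → ℕ → Bool
inBlock a l x = (a ≤ᵇ x) ∧ (x <ᵇ a + l)

prob : (n : ℕ) .{{_ : NonZero n}} (b t : ℕ) .{{_ : NonZero t}} (i a l : ℕ) → ℚ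
prob n b t i a l =
  (+ length (filterᵇ (λ β → inBlock a l (resid n (β * i))) (block b t))) / t

module Submission where

-- Write a = c₀ + 1 and, for β ≥ 1, let y = β·i − 1, so that the representative of β·i
-- in [n] is (y mod n) + 1.  Cut [0, c·n), c = ⌈im/n⌉, into c windows of length n and
-- encode β by  (y div n)·Q + ⌊(y mod n − c₀)/i⌋,  where Q = 1 + ⌊l/i⌋.  For every β ∈ T
-- with β·i mod n ∈ S this code is below c·Q (y < β·i ≤ i·m ≤ c·n, and the offset inside
-- S is below Q because l < Q·i), and it strictly increases with β: adding δ to β either
-- moves y to a later window or, within the same window, raises the offset by exactly δ.
-- Hence at most c·Q multipliers hit S, which is the first inequality.  The second one is
-- arithmetic once ⌊l/i⌋ and ⌈im/n⌉ are replaced by naturals f, c with f·i ≤ l and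
-- c·n < i·m + n.

module Combinatorics where

  open import Data.Bool using (Bool; true; false)
  open import Data.Bool.Properties using (T-≡; T-∧)
  open import Data.Nat
  open import Data.Nat.Properties
  open import Data.Nat.DivMod
  open import Data.Nat.Divisibility using (n∣m*n)
  open import Data.List using (length; filterᵇ; applyUpTo)
  open import Data.List.Properties using (map-applyUpTo)
  open import Data.Product using (_×_; _,_; proj₁; proj₂)
  open import Data.Sum using (inj₁; inj₂)
  open import Function using (_∘_; Equivalence)
  open import Relation.Binary.PropositionalEquality
  open import Defs

  module _ {A : Set} (P : A → Bool) (code : A → ℕ) where

    CodesWithin : ℕ → ℕ → (ℕ → A) → ℕ → Set
    CodesWithin lo N g t = ∀ k → k < t → P (g k) ≡ true → lo ≤ code (g k) × code (g k) < N

    CodesIncreasing : (ℕ → A) → ℕ → Set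
    CodesIncreasing g t =
      ∀ j k → j < k → k < t → P (g j) ≡ true → P (g k) ≡ true → code (g j) < code (g k)

    codesIncreasing-tail : ∀ g t → CodesIncreasing g (suc t) → CodesIncreasing (g ∘ suc) t
    codesIncreasing-tail g t increasing j k j<k k<t =
      increasing (suc j) (suc k) (s<s j<k) (s<s k<t)

    -- When g 0 is selected, the remaining selected codes lie above code (g 0), so the
    -- available range shrinks by at least one.
    count-by-code : ∀ lo N (g : ℕ → A) t → CodesWithin lo N g t → CodesIncreasing g t →
      length (filterᵇ P (applyUpTo g t)) ≤ N ∸ lo
    count-by-code lo N g zero within increasing = z≤n
    count-by-code lo N g (suc t) within increasing with P (g 0) in selected
    ... | false = count-by-code lo N (g ∘ suc) t
                    (λ k k<t → within (suc k) (s<s k<t)) (codesIncreasing-tail g t increasing)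
    ... | true = begin
      suc (length (filterᵇ P (applyUpTo (g ∘ suc) t)))
        ≤⟨ s≤s (count-by-code (suc (code (g 0))) N (g ∘ suc) t above-first
                  (codesIncreasing-tail g t increasing)) ⟩
      suc (N ∸ suc (code (g 0)))  ≡⟨ +-∸-assoc 1 (proj₂ first) ⟨
      N ∸ code (g 0)              ≤⟨ ∸-monoʳ-≤ N (proj₁ first) ⟩
      N ∸ lo                      ∎
      where
        open ≤-Reasoning
        first : lo ≤ code (g 0) × code (g 0) < N
        first = within 0 z<s selected
        above-first : CodesWithin (suc (code (g 0))) N (g ∘ suc) t
        above-first k k<t sel =
          increasing 0 (suc k) z<s (s<s k<t) selected sel , proj₂ (within (suc k) (s<s k<t) sel)

  suc-% : ∀ n .{{_ : NonZero n}} y → suc y % n ≡ suc (y % n) % n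
  suc-% n y = begin
    suc y % n                    ≡⟨ cong (λ z → suc z % n) (m≡m%n+[m/n]*n y n) ⟩
    suc (y % n + y / n * n) % n  ≡⟨ [m+kn]%n≡m%n (suc (y % n)) (y / n) n ⟩
    suc (y % n) % n              ∎
    where open ≡-Reasoning

  -- (y % n) + 1 is either below n, or equal to n, which is how resid represents 0.
  resid-suc : ∀ n .{{_ : NonZero n}} y → resid n (suc y) ≡ suc (y % n)
  resid-suc n y rewrite suc-% n y with m≤n⇒m<n∨m≡n (m%n<n y n)
  ... | inj₁ r+1<n rewrite m<n⇒m%n≡m r+1<n = refl
  ... | inj₂ r+1≡n rewrite trans (cong (_% n) r+1≡n) (n%n≡0 n) = sym r+1≡n

  resid-pred : ∀ n .{{_ : NonZero n}} x .{{_ : NonZero x}} → resid n x ≡ suc (pred x % n)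
  resid-pred n (suc y) = resid-suc n y

  inBlock-suc : ∀ c₀ l r → inBlock (suc c₀) l (suc r) ≡ true → c₀ ≤ r × r < c₀ + l
  inBlock-suc c₀ l r member with Equivalence.to T-∧ (Equivalence.from T-≡ member)
  ... | lower , upper =
    s≤s⁻¹ (≤ᵇ⇒≤ (suc c₀) (suc r) lower) , s<s⁻¹ (<ᵇ⇒< (suc r) (suc c₀ + l) upper)

  same-quotient⇒%-+ : ∀ n .{{_ : NonZero n}} y z → y / n ≡ (y + z) / n → (y + z) % n ≡ y % n + z
  same-quotient⇒%-+ n y z same = +-cancelʳ-≡ (y / n * n) _ _ (begin
    (y + z) % n + y / n * n        ≡⟨ cong (λ k → (y + z) % n + k * n) same ⟩
    (y + z) % n + (y + z) / n * n  ≡⟨ m≡m%n+[m/n]*n (y + z) n ⟨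
    y + z                          ≡⟨ cong (_+ z) (m≡m%n+[m/n]*n y n) ⟩
    y % n + y / n * n + z          ≡⟨ +-assoc (y % n) (y / n * n) z ⟩
    y % n + (y / n * n + z)        ≡⟨ cong (y % n +_) (+-comm (y / n * n) z) ⟩
    y % n + (z + y / n * n)        ≡⟨ +-assoc (y % n) z (y / n * n) ⟨
    y % n + z + y / n * n          ∎)
    where open ≡-Reasoning

  -- Mixed-radix codes k·Q + q with q < Q are ordered lexicographically.
  below-next-block : ∀ Q k q → q < Q → k * Q + q < suc k * Q
  below-next-block Q k q q<Q = begin-strict
    k * Q + q  <⟨ +-monoʳ-< (k * Q) q<Q ⟩
    k * Q + Q  ≡⟨ +-comm (k * Q) Q ⟩
    suc k * Q  ∎
    where open ≤-Reasoning

  pred-+ : ∀ x .{{_ : NonZero x}} z → pred (x + z) ≡ pred x + z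
  pred-+ (suc x) z = refl

  -- A number y ≥ 0 stands for y + 1; it lies in window y / n, and when
  -- (y + 1) mod n falls in S = {c₀+1, …, c₀+l} its offset ⌊(y mod n − c₀)/i⌋ counts the
  -- steps of length i from the start of S.
  module Encoding (n i : ℕ) .{{_ : NonZero n}} .{{_ : NonZero i}} (c₀ l Q : ℕ) where

    Hit : ℕ → Set
    Hit y = c₀ ≤ y % n × y % n < c₀ + l

    offset : ℕ → ℕ
    offset y = (y % n ∸ c₀) / i

    code : ℕ → ℕ
    code y = y / n * Q + offset y

    offset-< : l < Q * i → ∀ y → Hit y → offset y < Q
    offset-< l<Qi y (c₀≤r , r<c₀+l) = m<n*o⇒m/o<n (begin-strict
      y % n ∸ c₀     <⟨ ∸-monoˡ-< r<c₀+l c₀≤r ⟩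
      c₀ + l ∸ c₀    ≡⟨ m+n∸m≡n c₀ l ⟩
      l              <⟨ l<Qi ⟩
      Q * i          ∎)
      where open ≤-Reasoning

    code-< : ∀ c y → y < c * n → offset y < Q → code y < c * Q
    code-< c y y<cn offset<Q = <-≤-trans (below-next-block Q (y / n) (offset y) offset<Q)
                                         (*-monoˡ-≤ Q (m<n*o⇒m/o<n {n = c} y<cn))

    offset-step : ∀ y δ → c₀ ≤ y % n → (y + δ * i) % n ≡ y % n + δ * i →
                  offset (y + δ * i) ≡ offset y + δ
    offset-step y δ c₀≤r same-window = begin
      ((y + δ * i) % n ∸ c₀) / i   ≡⟨ cong (λ r → (r ∸ c₀) / i) same-window ⟩
      (y % n + δ * i ∸ c₀) / i     ≡⟨ cong (_/ i) (+-∸-comm (δ * i) c₀≤r) ⟩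
      (y % n ∸ c₀ + δ * i) / i     ≡⟨ +-distrib-/-∣ʳ (y % n ∸ c₀) (n∣m*n δ) ⟩
      offset y + δ * i / i         ≡⟨ cong (offset y +_) (m*n/n≡m δ i) ⟩
      offset y + δ                 ∎
      where open ≡-Reasoning

    -- The code strictly increases along a progression with step i starting at a hit:
    -- either the window increases, or the window stays and the offset grows.
    code-step : ∀ y δ → 0 < δ → c₀ ≤ y % n → offset y < Q → code y < code (y + δ * i)
    code-step y δ 0<δ c₀≤r offset<Q with m≤n⇒m<n∨m≡n (/-monoˡ-≤ n (m≤m+n y (δ * i)))
    ... | inj₁ later-window = begin-strict
      code y                  <⟨ below-next-block Q (y / n) (offset y) offset<Q ⟩
      suc (y / n) * Q         ≤⟨ *-monoˡ-≤ Q later-window ⟩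
      (y + δ * i) / n * Q     ≤⟨ m≤m+n _ _ ⟩
      code (y + δ * i)        ∎
      where open ≤-Reasoning
    ... | inj₂ same-window = begin-strict
      y / n * Q + offset y          <⟨ +-monoʳ-< (y / n * Q) (m<m+n (offset y) 0<δ) ⟩
      y / n * Q + (offset y + δ)    ≡⟨ cong₂ (λ k q → k * Q + q) (sym same-window) offset≡ ⟨
      code (y + δ * i)              ∎
      where
        open ≤-Reasoning
        offset≡ : offset (y + δ * i) ≡ offset y + δ
        offset≡ = offset-step y δ c₀≤r (same-quotient⇒%-+ n y (δ * i) same-window)

    hits : ℕ → Bool
    hits β = inBlock (suc c₀) l (resid n (β * i))

    βcode : ℕ → ℕ
    βcode β = code (pred (β * i))

    hit-position : ∀ β .{{_ : NonZero β}} → hits β ≡ true → Hit (pred (β * i))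
    hit-position β hit = inBlock-suc c₀ l (pred (β * i) % n)
      (subst (λ x → inBlock (suc c₀) l x ≡ true) (resid-pred n (β * i)) hit)

    module _ (l<Qi : l < Q * i) where

      βcode-< : ∀ c β .{{_ : NonZero β}} → β * i ≤ c * n → hits β ≡ true → βcode β < c * Q
      βcode-< c β βi≤cn hit =
        code-< c (pred (β * i)) (<-≤-trans (m≤pred[n]⇒suc[m]≤n ≤-refl) βi≤cn)
          (offset-< l<Qi (pred (β * i)) (hit-position β hit))

      βcode-increasing : ∀ β β′ .{{_ : NonZero β}} → β < β′ → hits β ≡ true → βcode β < βcode β′
      βcode-increasing β β′ β<β′ hit =
        subst (βcode β <_) (cong code position-step)
          (code-step (pred (β * i)) (β′ ∸ β) (m<n⇒0<n∸m β<β′) (proj₁ hit-y) (offset-< l<Qi _ hit-y))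
        where
          hit-y : Hit (pred (β * i))
          hit-y = hit-position β hit
          position-step : pred (β * i) + (β′ ∸ β) * i ≡ pred (β′ * i)
          position-step = begin
            pred (β * i) + (β′ ∸ β) * i  ≡⟨ pred-+ (β * i) ((β′ ∸ β) * i) ⟨
            pred (β * i + (β′ ∸ β) * i)  ≡⟨ cong pred (*-distribʳ-+ i β (β′ ∸ β)) ⟨
            pred ((β + (β′ ∸ β)) * i)    ≡⟨ cong (λ γ → pred (γ * i)) (m+[n∸m]≡n (<⇒≤ β<β′)) ⟩
            pred (β′ * i)                ∎
            where open ≡-Reasoning

  hits-bound : ∀ n i .{{_ : NonZero n}} .{{_ : NonZero i}} c₀ l Q → l < Q * i →
    ∀ m c b t → 1 ≤ b → b + t ∸ 1 ≤ m → i * m ≤ c * n →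
    length (filterᵇ (Encoding.hits n i c₀ l Q) (block b t)) ≤ c * Q
  hits-bound n i c₀ l Q l<Qi m c b t 1≤b b+t∸1≤m im≤cn =
    subst (λ βs → length (filterᵇ hits βs) ≤ c * Q) (sym (map-applyUpTo (λ k → k) (b +_) t))
      (count-by-code hits βcode 0 (c * Q) (b +_) t within increasing)
    where
      open Encoding n i c₀ l Q

      β≢0 : ∀ k → NonZero (b + k)
      β≢0 k = >-nonZero (≤-trans 1≤b (m≤m+n b k))

      within : CodesWithin hits βcode 0 (c * Q) (b +_) t
      within k k<t hit = z≤n , βcode-< l<Qi c (b + k) {{β≢0 k}} βi≤cn hit
        where
          βi≤cn : (b + k) * i ≤ c * n
          βi≤cn = begin
            (b + k) * i  ≤⟨ *-monoˡ-≤ i (≤-trans (∸-monoˡ-≤ 1 (+-monoʳ-< b k<t)) b+t∸1≤m) ⟩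
            m * i        ≡⟨ *-comm m i ⟩
            i * m        ≤⟨ im≤cn ⟩
            c * n        ∎
            where open ≤-Reasoning

      increasing : CodesIncreasing hits βcode (b +_) t
      increasing j k j<k _ hit _ = βcode-increasing l<Qi (b + j) (b + k) {{β≢0 j}} (+-monoʳ-< b j<k) hit

module FloorCeiling where

  open import Data.Nat as ℕ using (ℕ; suc; NonZero)
  open import Data.Integer as ℤ using (ℤ; +_; -[1+_]; _*_; -_; _≤_; _<_; +<+; -<+)
  open import Data.Integer.Properties
  open import Data.Integer.DivMod using ([n/d]*d≤n; n<s[n/ℕd]*d; div-pos-is-/ℕ)
  open import Data.Rational using (ℚ; mkℚ; ↥_; ↧_; floor; ceiling; _/_)
  import Data.Rational as ℚ
  open import Data.Rational.Properties using (↥-/; ↧-/; ↥-neg; ↧-neg)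
  import Data.Nat.GCD as ℕ
  open import Data.Product using (Σ; _×_; _,_; proj₁; proj₂; uncurry)
  open import Data.Integer.Tactic.RingSolver using (solve-∀)
  open import Data.Sum using (inj₂)
  open import Relation.Binary.PropositionalEquality
  open import Relation.Nullary using (contradiction)

  floor-bounds : ∀ p → floor p * ↧ p ≤ ↥ p × ↥ p < ℤ.suc (floor p) * ↧ p
  floor-bounds (mkℚ num d-1 _) =
    [n/d]*d≤n num (+ suc d-1) ,
    subst (λ q → num < ℤ.suc q * + suc d-1) (sym (div-pos-is-/ℕ num (suc d-1))) (n<s[n/ℕd]*d num (suc d-1))

  floor-bounds-scaled : ∀ p z d g .{{_ : NonZero g}} → ↥ p * + g ≡ z → ↧ p * + g ≡ + d →
    floor p * + d ≤ z × z < ℤ.suc (floor p) * + d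
  floor-bounds-scaled p z d g@(suc _) ↥p*g≡z ↧p*g≡d with floor-bounds p
  ... | lower , upper =
    subst₂ _≤_ (scale (floor p)) ↥p*g≡z (*-monoʳ-≤-nonNeg (+ g) lower) ,
    subst₂ _<_ ↥p*g≡z (scale (ℤ.suc (floor p))) (*-monoʳ-<-pos (+ g) upper)
    where
      scale : ∀ k → k * ↧ p * + g ≡ k * + d
      scale k = trans (*-assoc k (↧ p) (+ g)) (cong (k *_) ↧p*g≡d)

  ceiling≡-floor-neg : ∀ p → ceiling p ≡ - floor (ℚ.- p)
  ceiling≡-floor-neg (mkℚ _ _ _) = refl

  -- Bounds on the floor and ceiling of a fraction x / d of natural numbers: the reduced
  -- numerator and denominator of x / d are x and d divided by g = gcd x d.
  module _ (x d : ℕ) .{{_ : NonZero d}} where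

    private
      g : ℕ
      g = ℕ.gcd x d

      instance
        g≢0 : NonZero g
        g≢0 = ℕ.≢-nonZero (ℕ.gcd[m,n]≢0 x d (inj₂ (ℕ.≢-nonZero⁻¹ d)))

      p : ℚ
      p = + x / d

    floor-/ : floor (+ x / d) * + d ≤ + x × + x < ℤ.suc (floor (+ x / d)) * + d
    floor-/ = floor-bounds-scaled p (+ x) d g (↥-/ (+ x) d) (↧-/ (+ x) d)

    ceiling-/ : + x ≤ ceiling (+ x / d) * + d × ceiling (+ x / d) * + d < + x ℤ.+ + d
    ceiling-/ = x≤Cd , Cd<x+d
      where
        -- ceiling p = - F for F = floor (- p), and F·d ≤ - x < (F + 1)·d
        F : ℤ
        F = floor (ℚ.- p)

        ↥-p*g : ↥ (ℚ.- p) * + g ≡ - + x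
        ↥-p*g = begin
          ↥ (ℚ.- p) * + g ≡⟨ cong (_* + g) (↥-neg p) ⟩
          (- ↥ p) * + g   ≡⟨ neg-distribˡ-* (↥ p) (+ g) ⟨
          - (↥ p * + g)   ≡⟨ cong -_ (↥-/ (+ x) d) ⟩
          - + x           ∎
          where open ≡-Reasoning

        bounds : F * + d ≤ - + x × - + x < ℤ.suc F * + d
        bounds = floor-bounds-scaled (ℚ.- p) (- + x) d g ↥-p*g
                   (trans (cong (_* + g) (↧-neg p)) (↧-/ (+ x) d))

        C≡-F : ceiling p ≡ - F
        C≡-F = ceiling≡-floor-neg p

        x≤Cd : + x ≤ ceiling p * + d
        x≤Cd = begin
          + x           ≡⟨ neg-involutive (+ x) ⟨
          - - + x       ≤⟨ neg-mono-≤ (proj₁ bounds) ⟩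
          - (F * + d)   ≡⟨ neg-distribˡ-* F (+ d) ⟩
          (- F) * + d   ≡⟨ cong (_* + d) C≡-F ⟨
          ceiling p * + d ∎
          where open ≤-Reasoning

        Cd<x+d : ceiling p * + d < + x ℤ.+ + d
        Cd<x+d = begin-strict
          ceiling p * + d                  ≡⟨ cong (_* + d) C≡-F ⟩
          (- F) * + d                      ≡⟨ shift F (+ d) ⟩
          - (ℤ.suc F * + d) ℤ.+ + d        <⟨ +-monoˡ-< (+ d) (neg-mono-< (proj₂ bounds)) ⟩
          - - + x ℤ.+ + d                  ≡⟨ cong (ℤ._+ + d) (neg-involutive (+ x)) ⟩
          + x ℤ.+ + d                      ∎
          where
            open ≤-Reasoning
            shift : ∀ F e → (- F) * e ≡ - ((+ 1 ℤ.+ F) * e) ℤ.+ e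
            shift = solve-∀

  natural-floor : ∀ F x d → F * + d ≤ + x → + x < ℤ.suc F * + d →
    Σ ℕ λ f → F ≡ + f × f ℕ.* d ℕ.≤ x × x ℕ.< suc f ℕ.* d
  natural-floor (+ f) x d lower upper =
    f , refl , drop‿+≤+ (subst (_≤ + x) (sym (pos-* f d)) lower)
             , drop‿+<+ (subst (+ x <_) (sym (pos-* (suc f) d)) upper)
  natural-floor -[1+ k ] x d _ upper =
    contradiction (<-≤-trans upper (*-monoʳ-≤-nonNeg (+ d) (i<j⇒suc[i]≤j (-<+ {k} {0})))) λ { (+<+ ()) }

  natural-ceiling : ∀ C x d .{{_ : NonZero d}} → + x ≤ C * + d → C * + d < + x ℤ.+ + d →
    Σ ℕ λ c → C ≡ + c × x ℕ.≤ c ℕ.* d × c ℕ.* d ℕ.< x ℕ.+ d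
  natural-ceiling (+ c) x d lower upper =
    c , refl , drop‿+≤+ (subst (+ x ≤_) (sym (pos-* c d)) lower)
             , drop‿+<+ (subst (_< + (x ℕ.+ d)) (sym (pos-* c d)) upper)
  natural-ceiling -[1+ k ] x d@(suc _) lower _ =
    contradiction (≤-<-trans lower (*-monoʳ-<-pos (+ d) (-<+ {k} {0}))) λ { (+<+ ()) }

  floor-/-ℕ : ∀ x d .{{_ : NonZero d}} →
    Σ ℕ λ f → floor (+ x / d) ≡ + f × f ℕ.* d ℕ.≤ x × x ℕ.< suc f ℕ.* d
  floor-/-ℕ x d = uncurry (natural-floor (floor (+ x / d)) x d) (floor-/ x d)

  ceiling-/-ℕ : ∀ x d .{{_ : NonZero d}} →
    Σ ℕ λ c → ceiling (+ x / d) ≡ + c × x ℕ.≤ c ℕ.* d × c ℕ.* d ℕ.< x ℕ.+ d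
  ceiling-/-ℕ x d = uncurry (natural-ceiling (ceiling (+ x / d)) x d) (ceiling-/ x d)

module Fractions where

  open import Data.Nat using (ℕ; suc; pred; NonZero; _*_; _+_; _≤_; _<_)
  open import Data.Nat.Properties using (m*n≢0; *-monoˡ-≤; *-mono-≤; +-monoʳ-≤; <⇒≤; module ≤-Reasoning)
  open import Data.Nat.Tactic.RingSolver using (solve-∀)
  open import Data.Integer as ℤ using (+_; +≤+)
  import Data.Integer.Properties as ℤ
  open import Data.Rational using (_/_; toℚᵘ) renaming (_≤_ to _≤ℚ_; _+_ to _+ℚ_)
  open import Data.Rational.Properties using (toℚᵘ-fromℚᵘ; toℚᵘ-cancel-≤; toℚᵘ-injective; toℚᵘ-homo-+)
  open import Data.Rational.Unnormalised as ℚᵘ using (mkℚᵘ; *≤*; *≡*) renaming (_≃_ to _≃ᵘ_; _+_ to _+ᵘ_)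
  import Data.Rational.Unnormalised.Properties as ℚᵘ
  open import Relation.Binary.PropositionalEquality
  open import Defs using (nz*)

  toℚᵘ-/ : ∀ a d .{{_ : NonZero d}} → toℚᵘ (+ a / d) ≃ᵘ mkℚᵘ (+ a) (pred d)
  toℚᵘ-/ a (suc d) = toℚᵘ-fromℚᵘ (mkℚᵘ (+ a) d)

  /-mono-≤ : ∀ a b d e .{{_ : NonZero d}} .{{_ : NonZero e}} →
    a * e ≤ b * d → + a / d ≤ℚ + b / e
  /-mono-≤ a b d@(suc _) e@(suc _) ae≤bd = toℚᵘ-cancel-≤
    (ℚᵘ.≤-respˡ-≃ (ℚᵘ.≃-sym (toℚᵘ-/ a d)) (ℚᵘ.≤-respʳ-≃ (ℚᵘ.≃-sym (toℚᵘ-/ b e))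
      (*≤* (subst₂ ℤ._≤_ (ℤ.pos-* a e) (ℤ.pos-* b d) (+≤+ ae≤bd)))))

  -- Addition of fractions of naturals: first for unnormalised fractions, where it is the
  -- textbook formula, then transported to ℚ through toℚᵘ.
  mkℚᵘ-+ : ∀ a b d e .{{_ : NonZero d}} .{{_ : NonZero e}} →
    mkℚᵘ (+ a) (pred d) +ᵘ mkℚᵘ (+ b) (pred e) ≃ᵘ mkℚᵘ (+ (a * e + b * d)) (pred (d * e))
  mkℚᵘ-+ a b d@(suc _) e@(suc _) = *≡* (cong (ℤ._* (+ (d * e))) numerator)
    where
      numerator : + a ℤ.* + e ℤ.+ + b ℤ.* + d ≡ + (a * e + b * d)
      numerator = trans (cong₂ ℤ._+_ (sym (ℤ.pos-* a e)) (sym (ℤ.pos-* b d)))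
                        (sym (ℤ.pos-+ (a * e) (b * d)))

  /-+ : ∀ a b d e .{{_ : NonZero d}} .{{_ : NonZero e}} →
    + a / d +ℚ + b / e ≡ + (a * e + b * d) / (d * e)
  /-+ a b d e = toℚᵘ-injective (begin
    toℚᵘ (+ a / d +ℚ + b / e)                  ≈⟨ toℚᵘ-homo-+ (+ a / d) (+ b / e) ⟩
    toℚᵘ (+ a / d) +ᵘ toℚᵘ (+ b / e)           ≈⟨ ℚᵘ.+-cong (toℚᵘ-/ a d) (toℚᵘ-/ b e) ⟩
    mkℚᵘ (+ a) (pred d) +ᵘ mkℚᵘ (+ b) (pred e) ≈⟨ mkℚᵘ-+ a b d e ⟩
    mkℚᵘ (+ (a * e + b * d)) (pred (d * e))    ≈⟨ ℚᵘ.≃-sym (toℚᵘ-/ (a * e + b * d) (d * e)) ⟩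
    toℚᵘ (+ (a * e + b * d) / (d * e))         ∎)
    where open ℚᵘ.≃-Reasoning

  -- The four-term upper bound 1/t + im/(nt) + lm/(nt) + l/(it) dominates c(f+1)/t
  -- whenever c·n < i·m + n and f·i ≤ l: over the common denominator both sides are
  -- multiples of n·t⁴, namely (c·n)·(f+1)·i and (i·m + n)·(i + l).
  four-term-bound : ∀ m n t i c f .{{_ : NonZero n}} .{{_ : NonZero t}} .{{_ : NonZero i}} (l : ℕ) →
    c * n < i * m + n → f * i ≤ l →
    + (c * suc f) / t ≤ℚ + 1 / t +ℚ + (i * m) / (n * t) +ℚ + (l * m) / (n * t) +ℚ + l / (i * t)
  four-term-bound m n t i c f {{_}} {{t≢0}} l cn<im+n fi≤l =
    subst (+ (c * suc f) / t ≤ℚ_) (sym as-one-fraction)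
      (/-mono-≤ (c * suc f) X t D {{t≢0}} {{D≢0}} cross-multiplied)
    where
      -- numerators and denominators produced by adding the fractions one at a time
      X₁ X₂ X D₁ D₂ D : ℕ
      X₁ = 1 * (n * t) + i * m * t
      D₁ = t * (n * t)
      X₂ = X₁ * (n * t) + l * m * D₁
      D₂ = D₁ * (n * t)
      X  = X₂ * (i * t) + l * D₂
      D  = D₂ * (i * t)

      -- supplied explicitly: instance search does not unfold the names D₁, D₂, D
      D₁≢0 : NonZero D₁
      D₁≢0 = m*n≢0 t (n * t)
      D₂≢0 : NonZero D₂
      D₂≢0 = m*n≢0 D₁ (n * t) {{D₁≢0}}
      D≢0 : NonZero D
      D≢0 = m*n≢0 D₂ (i * t) {{D₂≢0}}

      as-one-fraction : + 1 / t +ℚ + (i * m) / (n * t) +ℚ + (l * m) / (n * t) +ℚ + l / (i * t)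
                        ≡ (+ X / D) {{D≢0}}
      as-one-fraction = begin
        + 1 / t +ℚ + (i * m) / (n * t) +ℚ + (l * m) / (n * t) +ℚ + l / (i * t)
          ≡⟨ cong (λ p → p +ℚ + (l * m) / (n * t) +ℚ + l / (i * t)) (/-+ 1 (i * m) t (n * t)) ⟩
        (+ X₁ / D₁) {{D₁≢0}} +ℚ + (l * m) / (n * t) +ℚ + l / (i * t)
          ≡⟨ cong (_+ℚ + l / (i * t)) (/-+ X₁ (l * m) D₁ (n * t) {{D₁≢0}}) ⟩
        (+ X₂ / D₂) {{D₂≢0}} +ℚ + l / (i * t)
          ≡⟨ /-+ X₂ l D₂ (i * t) {{D₂≢0}} ⟩
        (+ X / D) {{D≢0}} ∎
        where open ≡-Reasoning

      cross-multiplied : c * suc f * D ≤ X * t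
      cross-multiplied = begin
        c * suc f * D                                   ≡⟨ lhs-factored c f t n i ⟩
        (c * n) * (i + f * i) * (n * t * t * t * t)     ≤⟨ *-monoˡ-≤ (n * t * t * t * t) bound ⟩
        (i * m + n) * (i + l) * (n * t * t * t * t)     ≡⟨ rhs-factored i m n t l ⟨
        X * t                                           ∎
        where
          open ≤-Reasoning
          bound : (c * n) * (i + f * i) ≤ (i * m + n) * (i + l)
          bound = *-mono-≤ (<⇒≤ cn<im+n) (+-monoʳ-≤ i fi≤l)
          lhs-factored : ∀ c f t n i →
            c * (1 + f) * (t * (n * t) * (n * t) * (i * t)) ≡ (c * n) * (i + f * i) * (n * t * t * t * t)
          lhs-factored = solve-∀
          rhs-factored : ∀ i m n t l →
            (((1 * (n * t) + i * m * t) * (n * t) + l * m * (t * (n * t))) * (i * t)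
                + l * (t * (n * t) * (n * t))) * t
              ≡ (i * m + n) * (i + l) * (n * t * t * t * t)
          rhs-factored = solve-∀

open Combinatorics using (hits-bound)
open FloorCeiling using (floor-/-ℕ; ceiling-/-ℕ)
open Fractions using (/-mono-≤; four-term-bound)

open import Defs
open import Data.Nat using (ℕ; _+_; _*_; _∸_; _≤_; NonZero)
open import Data.Integer using (+_) renaming (_*_ to _*ℤ_; _+_ to _+ℤ_)
open import Data.Rational using (ℚ; _/_; floor; ceiling) renaming (_≤_ to _≤ℚ_; _+_ to _+ℚ_)
open import Data.Product using (_×_)

open import Data.Nat using (suc; zero)
open import Data.Nat.Properties using (*-monoˡ-≤)
open import Data.Integer.Properties using (pos-*)
open import Data.Product using (_,_)
open import Data.List using (length; filterᵇ)
open import Relation.Binary.PropositionalEquality using (_≡_; sym; trans; cong₂; subst)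

lemma4p3 : (m n t : ℕ) .{{_ : NonZero m}} .{{_ : NonZero n}} .{{_ : NonZero t}}
    → (b : ℕ) → 1 ≤ b → b + t ∸ 1 ≤ m
    → (i : ℕ) .{{_ : NonZero i}} → i ≤ n
    → (a l : ℕ) → 1 ≤ a → a + l ∸ 1 ≤ n
    → (prob n b t i a l ≤ℚ (ceiling ((+ (i * m)) / n) *ℤ (+ 1 +ℤ floor ((+ l) / i))) / t)
      × ((ceiling ((+ (i * m)) / n) *ℤ (+ 1 +ℤ floor ((+ l) / i))) / t
         ≤ℚ ((((+ 1) / t) +ℚ ((+ (i * m)) / (n * t))) +ℚ ((+ (l * m)) / (n * t))) +ℚ ((+ l) / (i * t)))
lemma4p3 m n t b 1≤b b+t∸1≤m i _ zero l () _
lemma4p3 m n t b 1≤b b+t∸1≤m i _ (suc c₀) l _ _ =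
  let (f , ⌊l/i⌋≡f , fi≤l , l<[1+f]i) = floor-/-ℕ l i
      (c , ⌈im/n⌉≡c , im≤cn , cn<im+n) = ceiling-/-ℕ (i * m) n
      bound≡ : ceiling ((+ (i * m)) / n) *ℤ (+ 1 +ℤ floor ((+ l) / i)) ≡ + (c * suc f)
      bound≡ = trans (cong₂ (λ x y → x *ℤ (+ 1 +ℤ y)) ⌈im/n⌉≡c ⌊l/i⌋≡f) (sym (pos-* c (suc f)))
      hits : ℕ
      hits = length (filterᵇ (λ β → inBlock (suc c₀) l (resid n (β * i))) (block b t))
      hits≤ : hits ≤ c * suc f
      hits≤ = hits-bound n i c₀ l (suc f) l<[1+f]i m c b t 1≤b b+t∸1≤m im≤cn
  in subst (λ q → prob n b t i (suc c₀) l ≤ℚ q / t) (sym bound≡) (/-mono-≤ hits (c * suc f) t t (*-monoˡ-≤ t hits≤))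
   , subst (λ q → q / t ≤ℚ ((((+ 1) / t) +ℚ ((+ (i * m)) / (n * t))) +ℚ ((+ (l * m)) / (n * t))) +ℚ ((+ l) / (i * t)))
           (sym bound≡) (four-term-bound m n t i c f l cn<im+n fi≤l)
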